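{- Let $k,\ell\ge0$ and $1\le m\le n$, fix $\pi=\pi_1\cdots\pi_n\in\mathfrak{S}_{m,n}$, and let $i\in[n]$ with $\pi_i>0$. Let $\mathrm{Pref}(\pi_i)$ be the set of $a\in[n]$ such that a car with preference $a$, arriving at the street with spots $1,\dots,n$ in which exactly the spots $u$ with $0<\pi_u<\pi_i$ are occupied, parks in spot $i$ under the $(k,\ell)$-pullback rule. Then $|\mathrm{Pref}(\pi_i)|=\mathrm{B}(\pi_i)+\mathrm{F}(\pi_i)+1$, where $\mathrm{B}(\pi_i)=\min(\mathrm{Right}(\pi_i),k)$ and $\mathrm{F}(\pi_i)$ equals $0$ if $\mathrm{Left}(\pi_i)=0$, $\min(i-1,\ell)$ if $0<\mathrm{Left}(\pi_i)=i-1$, and $\max(\min(\mathrm{Left}(\pi_i)-k,\ell),0)$ if $0<\mathrm{Left}(\pi_i)<i-1$.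
   Context: $(k,\ell)$-pullback parking rule: a car with preference $a$ drives to spot $a$ and parks there if it is empty; otherwise it checks spots $a-1,\dots,a-k$ in this order (stopping at the start of the street) and parks in the first empty one; if none, it checks spots $a+1,\dots,a+\ell$ in order (not beyond spot $n$) and parks in the first empty one; otherwise it fails. $\mathfrak{S}_{m,n}$ is the set of words $\pi_1\cdots\pi_n$ that are permutations of the multiset of $n-m$ zeros and the elements of $[m]$. $\mathrm{Right}(\pi_i)$ is the largest $x\ge0$ with $0<\pi_t<\pi_i$ for all $i+1\le t\le i+x\le n$; $\mathrm{Left}(\pi_i)$ is the largest $x\ge0$ with $0<\pi_t<\pi_i$ for all $1\le i-x\le t\le i-1$. -}

module Defs where

open import Data.Nat using (ℕ; zero; suc; _+_; _∸_; _⊓_; _<ᵇ_; _≤ᵇ_; _≡ᵇ_)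
open import Data.Bool using (Bool; true; false; if_then_else_; _∧_)
open import Data.Maybe using (Maybe; just; nothing)
open import Data.List using (List; []; _∷_; _++_; replicate; map; upTo)
open import Data.List.Relation.Binary.Permutation.Propositional using (_↭_)

-- The multiset {0^(n-m), 1, ..., m} as a list; 𝔖_{m,n} = its rearrangements.
baseMultiset : ℕ → ℕ → List ℕ
baseMultiset m n = replicate (n ∸ m) 0 ++ map suc (upTo m)

InS : ℕ → ℕ → List ℕ → Set
InS m n π = π ↭ baseMultiset m n

-- 1-indexed access π_u (returns 0 outside 1..length)
at : List ℕ → ℕ → ℕ
at [] _ = 0
at (x ∷ xs) zero = 0
at (x ∷ xs) (suc zero) = x
at (x ∷ xs) (suc (suc u)) = at xs (suc u)

occ : List ℕ → ℕ → ℕ → Bool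
occ π i u = (0 <ᵇ at π u) ∧ (at π u <ᵇ at π i)

backFrom : (ℕ → Bool) → ℕ → ℕ → Maybe ℕ
backFrom o zero _ = nothing
backFrom o (suc p) zero = nothing
backFrom o (suc p) (suc f) = if o (suc p) then backFrom o p f else just (suc p)

fwdFrom : (ℕ → Bool) → ℕ → ℕ → ℕ → Maybe ℕ
fwdFrom o n p zero = nothing
fwdFrom o n p (suc f) =
  if p ≤ᵇ n then (if o p then fwdFrom o n (suc p) f else just p) else nothing

orElse : Maybe ℕ → Maybe ℕ → Maybe ℕ
orElse (just x) _ = just x
orElse nothing y = y

park : ℕ → ℕ → ℕ → (ℕ → Bool) → ℕ → Maybe ℕ
park k ℓ n o a =
  if o a then orElse (backFrom o (a ∸ 1) k) (fwdFrom o n (suc a) ℓ) else just a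

isJust≡ : Maybe ℕ → ℕ → Bool
isJust≡ (just x) i = x ≡ᵇ i
isJust≡ nothing i = false

countTo : (ℕ → Bool) → ℕ → ℕ
countTo p zero = 0
countTo p (suc n) = countTo p n + (if p (suc n) then 1 else 0)

prefCount : ℕ → ℕ → ℕ → List ℕ → ℕ → ℕ
prefCount k ℓ n π i = countTo (λ a → isJust≡ (park k ℓ n (occ π i) a) i) n

runFwd : (ℕ → Bool) → ℕ → ℕ → ℕ → ℕ
runFwd o n p zero = 0
runFwd o n p (suc f) = if (p ≤ᵇ n) ∧ o p then suc (runFwd o n (suc p) f) else 0

runBack : (ℕ → Bool) → ℕ → ℕ
runBack o zero = 0
runBack o (suc p) = if o (suc p) then suc (runBack o p) else 0

Right : ℕ → List ℕ → ℕ → ℕ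
Right n π i = runFwd (occ π i) n (suc i) n

Left : List ℕ → ℕ → ℕ
Left π i = runBack (occ π i) (i ∸ 1)

B : ℕ → ℕ → List ℕ → ℕ → ℕ
B k n π i = Right n π i ⊓ k

-- F; for 0 < L < i-1, max(min(L-k,ℓ),0) = min(L ∸ k, ℓ) in ℕ
F : ℕ → ℕ → List ℕ → ℕ → ℕ
F k ℓ π i =
  if Left π i ≡ᵇ 0 then 0
  else if Left π i ≡ᵇ (i ∸ 1) then (i ∸ 1) ⊓ ℓ
  else (Left π i ∸ k) ⊓ ℓ

{-# OPTIONS --safe #-}
-- Since spot i is free, the preferences that end in spot i form an interval around i.
-- A car preferring a > i reaches i by backing up, which it does iff spots i+1, …, a are all
-- occupied (a ≤ i + Right) and a − i ≤ k.  A car preferring a < i reaches i by driving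
-- forward, which it does iff every spot from max(1, a − k) up to i − 1 is occupied and
-- i − a ≤ ℓ; comparing a − k with the nearest free spot i − 1 − Left below i (none when
-- Left = i − 1) turns this into i − a ≤ F.  The interval [i − F, i + B] has B + F + 1 elements.
module Submission where

open import Defs
open import Data.Nat using (ℕ; zero; suc; _+_; _∸_; _⊓_; _≤_; _<_; _≤?_; _<ᵇ_; _≤ᵇ_; _≡ᵇ_; z≤n; s≤s; s≤s⁻¹)
open import Data.Nat.Properties
open import Data.Bool using (Bool; true; false; if_then_else_; _∧_)
open import Data.Bool.Properties using (∧-zeroʳ; T-≡)
open import Data.Maybe using (just; nothing)
open import Data.Maybe.Properties using (just-injective)
open import Data.List using (List)
open import Data.Product using (_×_; _,_; proj₁; proj₂)
open import Data.Product.Function.NonDependent.Propositional using (_×-⇔_)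
open import Data.Sum using (_⊎_; inj₁; inj₂; [_,_]′)
open import Data.Sum.Function.Propositional using (_⊎-⇔_)
open import Function.Base using (id)
open import Function.Bundles using (_⇔_; mk⇔; Equivalence)
open import Function.Construct.Composition using (_⇔-∘_)
open import Function.Construct.Symmetry using (⇔-sym)
open import Function.Properties.Equivalence using () renaming (refl to ⇔-refl)
open import Function.Related.Propositional using (module EquationalReasoning)
open import Relation.Nullary using (yes; no; contradiction)
open import Relation.Binary.Definitions using (tri<; tri≈; tri>)
open import Relation.Binary.PropositionalEquality

open Equivalence using (to; from)

private variable
  o : ℕ → Bool
  lo hi m p x y : ℕ

≡⇒⇔ : {A B : Set} → A ≡ B → A ⇔ B
≡⇒⇔ refl = ⇔-refl

-- Spots are 1, 2, …; the guard 1 ≤ y lets a lower end such as a ∸ k fall off the street.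
Occupied : (ℕ → Bool) → ℕ → ℕ → Set
Occupied o lo hi = ∀ y → 1 ≤ y → lo ≤ y → y < hi → o y ≡ true

Occupied-empty : hi ≤ lo → Occupied o lo hi
Occupied-empty hi≤lo y _ lo≤y y<hi = contradiction (≤-trans y<hi hi≤lo) (≤⇒≯ lo≤y)

Occupied-before1 : Occupied o lo 1
Occupied-before1 y 1≤y _ y<1 = contradiction y<1 (≤⇒≯ 1≤y)

Occupied-⊆ : lo ≤ m → p ≤ hi → Occupied o lo hi → Occupied o m p
Occupied-⊆ lo≤m p≤hi occ y 1≤y m≤y y<p = occ y 1≤y (≤-trans lo≤m m≤y) (≤-trans y<p p≤hi)

Occupied-++ : Occupied o lo m → Occupied o m hi → Occupied o lo hi
Occupied-++ {m = m} left right y 1≤y lo≤y y<hi with y <? m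
... | yes y<m = left y 1≤y lo≤y y<m
... | no y≮m = right y 1≤y (≮⇒≥ y≮m) y<hi

Occupied-extendʳ : o hi ≡ true → Occupied o lo (suc hi) ⇔ Occupied o lo hi
Occupied-extendʳ {o} {hi} occ-hi = mk⇔ (λ occ y 1≤y lo≤y y<hi → occ y 1≤y lo≤y (m<n⇒m<1+n y<hi)) extend
  where
  extend : Occupied o _ hi → Occupied o _ (suc hi)
  extend occ y 1≤y lo≤y y≤hi with m≤n⇒m<n∨m≡n (s≤s⁻¹ y≤hi)
  ... | inj₁ y<hi = occ y 1≤y lo≤y y<hi
  ... | inj₂ refl = occ-hi

Occupied-extendˡ : o lo ≡ true → Occupied o lo hi ⇔ Occupied o (suc lo) hi
Occupied-extendˡ {o} {lo} occ-lo = mk⇔ (Occupied-⊆ (n≤1+n lo) ≤-refl) extend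
  where
  extend : Occupied o (suc lo) _ → Occupied o lo _
  extend occ y 1≤y lo≤y y<hi with m≤n⇒m<n∨m≡n lo≤y
  ... | inj₁ lo<y = occ y 1≤y lo<y y<hi
  ... | inj₂ refl = occ-lo

backFrom-just-≤ : ∀ p f → backFrom o p f ≡ just x → x ≤ p
backFrom-just-≤ zero f ()
backFrom-just-≤ (suc p) zero ()
backFrom-just-≤ {o} (suc p) (suc f) eq with o (suc p)
... | true = m≤n⇒m≤1+n (backFrom-just-≤ p f eq)
... | false = ≤-reflexive (just-injective (sym eq))

backFrom-nothing⇔ : ∀ p f → backFrom o p f ≡ nothing ⇔ Occupied o (suc p ∸ f) (suc p)
backFrom-nothing⇔ zero f = mk⇔ (λ _ → Occupied-before1) (λ _ → refl)
backFrom-nothing⇔ (suc p) zero = mk⇔ (λ _ → Occupied-empty ≤-refl) (λ _ → refl)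
backFrom-nothing⇔ {o} (suc p) (suc f) with o (suc p) in e
... | true = ⇔-sym (Occupied-extendʳ e) ⇔-∘ backFrom-nothing⇔ p f
... | false = mk⇔ (λ ()) (λ occ → contradiction (trans (sym e) (occ (suc p) (s≤s z≤n) (m∸n≤m (suc p) f) ≤-refl)) λ ())

backFrom-just⇔ : ∀ p f → 1 ≤ x → x ≤ p →
  backFrom o p f ≡ just x ⇔ (p < x + f × o x ≡ false × Occupied o (suc x) (suc p))
backFrom-just⇔ zero f 1≤x x≤0 = contradiction x≤0 (<⇒≱ 1≤x)
backFrom-just⇔ {x} (suc p) zero 1≤x x≤p =
  mk⇔ (λ ()) (λ (p<x+0 , _) → contradiction (subst (suc p <_) (+-identityʳ x) p<x+0) (≤⇒≯ x≤p))
backFrom-just⇔ {x} {o} (suc p) (suc f) 1≤x x≤p with o (suc p) in e | m≤n⇒m<n∨m≡n x≤p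
... | true | inj₁ x<p =
  ((≡⇒⇔ (cong (suc p <_) (sym (+-suc x f))) ⇔-∘ mk⇔ s≤s s≤s⁻¹) ×-⇔ ⇔-refl ×-⇔ ⇔-sym (Occupied-extendʳ e))
  ⇔-∘ backFrom-just⇔ p f 1≤x (s≤s⁻¹ x<p)
... | true | inj₂ refl =
  mk⇔ (λ eq → contradiction (backFrom-just-≤ p f eq) (n≮n p)) (λ (_ , free , _) → contradiction (trans (sym e) free) λ ())
... | false | inj₁ x<p =
  mk⇔ (λ eq → contradiction (just-injective eq) (>⇒≢ x<p))
      (λ (_ , _ , occ) → contradiction (trans (sym e) (occ (suc p) (s≤s z≤n) x<p ≤-refl)) λ ())
... | false | inj₂ refl = mk⇔ (λ _ → m<m+n (suc p) (s≤s z≤n) , e , Occupied-empty ≤-refl) (λ _ → refl)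

fwdFrom-just-≥ : ∀ n p f → fwdFrom o n p f ≡ just x → p ≤ x
fwdFrom-just-≥ n p zero ()
fwdFrom-just-≥ {o} n p (suc f) eq with p ≤ᵇ n | o p
... | true | true = <⇒≤ (fwdFrom-just-≥ n (suc p) f eq)
... | true | false = ≤-reflexive (just-injective eq)
fwdFrom-just-≥ n p (suc f) () | false | _

fwdFrom-just⇔ : ∀ n p f → p < x → x ≤ n →
  fwdFrom o n (suc p) f ≡ just x ⇔ (x < suc p + f × o x ≡ false × Occupied o (suc p) x)
fwdFrom-just⇔ {x} n p zero p<x x≤n =
  mk⇔ (λ ()) (λ (x<p+1+0 , _) → contradiction (subst (x <_) (+-identityʳ (suc p)) x<p+1+0) (≤⇒≯ p<x))
fwdFrom-just⇔ {x} {o} n p (suc f) p<x x≤n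
  rewrite to T-≡ (≤⇒≤ᵇ (≤-trans p<x x≤n)) with o (suc p) in e | m≤n⇒m<n∨m≡n p<x
... | true | inj₁ p+1<x =
  ((≡⇒⇔ (cong (x <_) (sym (+-suc (suc p) f)))) ×-⇔ ⇔-refl ×-⇔ ⇔-sym (Occupied-extendˡ e))
  ⇔-∘ fwdFrom-just⇔ n (suc p) f p+1<x x≤n
... | true | inj₂ refl =
  mk⇔ (λ eq → contradiction (fwdFrom-just-≥ n (suc (suc p)) f eq) (n≮n (suc p)))
      (λ (_ , free , _) → contradiction (trans (sym e) free) λ ())
... | false | inj₁ p+1<x =
  mk⇔ (λ eq → contradiction (just-injective eq) (<⇒≢ p+1<x))
      (λ (_ , _ , occ) → contradiction (trans (sym e) (occ (suc p) (s≤s z≤n) ≤-refl p+1<x)) λ ())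
... | false | inj₂ refl = mk⇔ (λ _ → m<m+n (suc p) (s≤s z≤n) , e , Occupied-empty ≤-refl) (λ _ → refl)

runBack-≤ : ∀ p → runBack o p ≤ p
runBack-≤ zero = z≤n
runBack-≤ {o} (suc p) with o (suc p)
... | true = s≤s (runBack-≤ p)
... | false = z≤n

-- p ∸ runBack o p is the nearest free spot at or below p, or 0 if there is none.
runBack⇔ : ∀ p → y ≤ suc p → Occupied o y (suc p) ⇔ (runBack o p ≡ p ⊎ p ∸ runBack o p < y)
runBack⇔ zero _ = mk⇔ (λ _ → inj₁ refl) (λ _ → Occupied-before1)
runBack⇔ {y} {o} (suc p) y≤p+2 with o (suc p) in e
... | false =
  mk⇔ (λ occ → inj₂ (≰⇒> λ y≤p+1 → contradiction (trans (sym e) (occ (suc p) (s≤s z≤n) y≤p+1 ≤-refl)) λ ()))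
      λ { (inj₁ ()) ; (inj₂ p+1<y) → Occupied-empty p+1<y }
... | true with m≤n⇒m<n∨m≡n y≤p+2
...   | inj₁ y<p+2 = (mk⇔ (cong suc) suc-injective ⊎-⇔ ⇔-refl) ⇔-∘ (runBack⇔ p (s≤s⁻¹ y<p+2) ⇔-∘ Occupied-extendʳ e)
...   | inj₂ refl = mk⇔ (λ _ → inj₂ (s≤s (≤-trans (m∸n≤m p (runBack o p)) (n≤1+n p)))) (λ _ → Occupied-empty ≤-refl)

runFwd-≤ : ∀ n p f → p ≤ n → p + runFwd o n (suc p) f ≤ n
runFwd-≤ n p zero p≤n = ≤-trans (≤-reflexive (+-identityʳ p)) p≤n
runFwd-≤ {o} n p (suc f) p≤n with suc p ≤ᵇ n in e₁ | o (suc p)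
... | true | true = ≤-trans (≤-reflexive (+-suc p _)) (runFwd-≤ n (suc p) f (≤ᵇ⇒≤ (suc p) n (from T-≡ e₁)))
... | true | false = ≤-trans (≤-reflexive (+-identityʳ p)) p≤n
... | false | _ = ≤-trans (≤-reflexive (+-identityʳ p)) p≤n

runFwd⇔ : ∀ n p f → p < y → y ≤ p + f →
  (Occupied o (suc p) (suc y) × y ≤ n) ⇔ y ≤ p + runFwd o n (suc p) f
runFwd⇔ {y} n p zero p<y y≤p =
  contradiction (≤-trans y≤p (≤-reflexive (+-identityʳ p))) (<⇒≱ p<y)
runFwd⇔ {y} {o} n p (suc f) p<y y≤p+f+1 with suc p ≤ᵇ n in e₁ | o (suc p) in e₂
... | false | _ =
  mk⇔ (λ (_ , y≤n) → contradiction (trans (sym e₁) (to T-≡ (≤⇒≤ᵇ (≤-trans p<y y≤n)))) λ ())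
      (λ y≤p → contradiction (≤-trans y≤p (≤-reflexive (+-identityʳ p))) (<⇒≱ p<y))
... | true | false =
  mk⇔ (λ (occ , _) → contradiction (trans (sym e₂) (occ (suc p) (s≤s z≤n) ≤-refl (s≤s p<y))) λ ())
      (λ y≤p → contradiction (≤-trans y≤p (≤-reflexive (+-identityʳ p))) (<⇒≱ p<y))
... | true | true with m≤n⇒m<n∨m≡n p<y
...   | inj₁ p+1<y =
  ≡⇒⇔ (cong (y ≤_) (sym (+-suc p _)))
  ⇔-∘ (runFwd⇔ n (suc p) f p+1<y (≤-trans y≤p+f+1 (≤-reflexive (+-suc p f))) ⇔-∘ (Occupied-extendˡ e₂ ×-⇔ ⇔-refl))
...   | inj₂ refl =
  mk⇔ (λ _ → ≤-trans (s≤s (m≤m+n p _)) (≤-reflexive (sym (+-suc p _))))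
      (λ _ → from (Occupied-extendʳ e₂) (Occupied-empty ≤-refl) , ≤ᵇ⇒≤ (suc p) n (from T-≡ e₁))

≤+⊓⇔ : ∀ m n p q → m ≤ n + (p ⊓ q) ⇔ (m ≤ n + p × m ≤ n + q)
≤+⊓⇔ m n p q = mk⇔
  (λ h → ≤-trans h (+-monoʳ-≤ n (m⊓n≤m p q)) , ≤-trans h (+-monoʳ-≤ n (m⊓n≤n p q)))
  (λ (h₁ , h₂) → subst (m ≤_) (sym (+-distribˡ-⊓ n p q)) (⊓-glb h₁ h₂))

<+∸⇔ : ∀ {m n o} → n ≤ m → m < n + o ⇔ m ∸ n < o
<+∸⇔ {m} {n} {o} n≤m = mk⇔
  (λ h → subst (_≤ o) (+-∸-assoc 1 n≤m) (m≤n+o⇒m∸n≤o (suc m) n h))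
  (λ h → ≤-trans (≤-reflexive m+1≡n+[m∸n+1]) (+-monoʳ-≤ n h))
  where
  m+1≡n+[m∸n+1] : suc m ≡ n + suc (m ∸ n)
  m+1≡n+[m∸n+1] = trans (cong suc (sym (m+[n∸m]≡n n≤m))) (sym (+-suc n (m ∸ n)))

∸<∸⇔ : ∀ {m n p q} → n ≤ m → m ∸ n < p ∸ q ⇔ m + q < p + n
∸<∸⇔ {m} {n} {p} {q} n≤m with q ≤? p
... | yes q≤p =
  ≡⇒⇔ (cong (_< p + n) m∸n+q+n≡m+q)
  ⇔-∘ (mk⇔ (+-monoˡ-< n) (+-cancelʳ-< n _ _) ⇔-∘ mk⇔ (m≤o∸n⇒m+n≤o (suc (m ∸ n)) q≤p) (m+n≤o⇒m≤o∸n (suc (m ∸ n))))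
  where
  m∸n+q+n≡m+q : m ∸ n + q + n ≡ m + q
  m∸n+q+n≡m+q = begin
    m ∸ n + q + n   ≡⟨ +-assoc (m ∸ n) q n ⟩
    m ∸ n + (q + n) ≡⟨ cong (m ∸ n +_) (+-comm q n) ⟩
    m ∸ n + (n + q) ≡⟨ +-assoc (m ∸ n) n q ⟨
    m ∸ n + n + q   ≡⟨ cong (_+ q) (m∸n+n≡m n≤m) ⟩
    m + q           ∎
    where open ≡-Reasoning
... | no q≰p = mk⇔
  (λ h → contradiction (subst (m ∸ n <_) (m≤n⇒m∸n≡0 (<⇒≤ p<q)) h) n≮0)
  (λ h → contradiction (≤-trans h (≤-reflexive (+-comm p n))) (<⇒≯ (+-mono-≤-< n≤m p<q)))
  where
  p<q : p < q
  p<q = ≰⇒> q≰p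

leftReach : ℕ → ℕ → ℕ → ℕ
leftReach k L j = if L ≡ᵇ j then j else L ∸ k

leftReach-≤ : ∀ k L j → L ≤ j → leftReach k L j ≤ j
leftReach-≤ k L j L≤j with L ≡ᵇ j
... | true = ≤-refl
... | false = ≤-trans (m∸n≤m L k) L≤j

leftReach⇔ : ∀ k {L j a} → L ≤ j → 1 ≤ a → a ≤ j →
  (L ≡ j ⊎ j ∸ L < a ∸ k) ⇔ j < a + leftReach k L j
leftReach⇔ k {L} {j} {a} L≤j 1≤a a≤j with L ≡ᵇ j in e
... | true = mk⇔ (λ _ → +-monoˡ-≤ j 1≤a) (λ _ → inj₁ (≡ᵇ⇒≡ L j (from T-≡ e)))
... | false = begin
  (L ≡ j ⊎ j ∸ L < a ∸ k) ∼⟨ mk⇔ [ (λ L≡j → contradiction (trans (sym e) (to T-≡ (≡⇒≡ᵇ L j L≡j))) λ ()) , id ]′ inj₂ ⟩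
  j ∸ L < a ∸ k           ∼⟨ ∸<∸⇔ L≤j ⟩
  j + k < a + L           ≡⟨ cong (j + k <_) (+-comm a L) ⟩
  j + k < L + a           ∼⟨ ⇔-sym (∸<∸⇔ a≤j) ⟩
  j ∸ a < L ∸ k           ∼⟨ ⇔-sym (<+∸⇔ a≤j) ⟩
  j < a + (L ∸ k)         ∎
  where open EquationalReasoning

F-cases≡leftReach⊓ℓ : ∀ k ℓ L j →
  (if L ≡ᵇ 0 then 0 else if L ≡ᵇ j then j ⊓ ℓ else (L ∸ k) ⊓ ℓ) ≡ leftReach k L j ⊓ ℓ
F-cases≡leftReach⊓ℓ k ℓ zero zero = refl
F-cases≡leftReach⊓ℓ k ℓ zero (suc j) = cong (_⊓ ℓ) (sym (0∸n≡0 k))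
F-cases≡leftReach⊓ℓ k ℓ (suc L) j with suc L ≡ᵇ j
... | true = refl
... | false = refl

isJust≡⇔ : ∀ r x → isJust≡ r x ≡ true ⇔ r ≡ just x
isJust≡⇔ nothing x = mk⇔ (λ ()) (λ ())
isJust≡⇔ (just y) x =
  mk⇔ (λ e → cong just (≡ᵇ⇒≡ y x (from T-≡ e))) (λ e → to T-≡ (≡⇒≡ᵇ y x (just-injective e)))

countTo-window : ∀ (P : ℕ → Bool) {c F B n} → F < c → c + B ≤ n →
  (∀ {a} → 1 ≤ a → a ≤ n → P a ≡ true ⇔ (c ≤ a + F × a ≤ c + B)) →
  countTo P n ≡ B + F + 1
countTo-window P {c} {F} {B} {n} F<c c+B≤n spec = begin
  countTo P n             ≡⟨ countTo-above n ≤-refl c+B≤n ⟩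
  countTo P (c + B)       ≡⟨ countTo-below (c + B) ≤-refl ⟩
  suc (c + B) + F ∸ c     ≡⟨ cong (_∸ c) c+B+1+F≡c+[B+F+1] ⟩
  c + (B + F + 1) ∸ c     ≡⟨ m+n∸m≡n c (B + F + 1) ⟩
  B + F + 1               ∎
  where
  open ≡-Reasoning

  c+B+1+F≡c+[B+F+1] : suc (c + B) + F ≡ c + (B + F + 1)
  c+B+1+F≡c+[B+F+1] = begin
    suc (c + B + F)   ≡⟨ cong suc (+-assoc c B F) ⟩
    suc (c + (B + F)) ≡⟨ +-suc c (B + F) ⟨
    c + suc (B + F)   ≡⟨ cong (c +_) (+-comm 1 (B + F)) ⟩
    c + (B + F + 1)   ∎

  countTo-below : ∀ m → m ≤ c + B → countTo P m ≡ suc m + F ∸ c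
  countTo-below zero _ = sym (m≤n⇒m∸n≡0 F<c)
  countTo-below (suc m) m<c+B with P (suc m) in e
  ... | true = begin
    countTo P m + 1     ≡⟨ cong (_+ 1) (countTo-below m (<⇒≤ m<c+B)) ⟩
    suc m + F ∸ c + 1   ≡⟨ +-∸-comm 1 c≤m+1+F ⟨
    suc m + F + 1 ∸ c   ≡⟨ cong (_∸ c) (+-comm (suc m + F) 1) ⟩
    suc (suc m + F) ∸ c ∎
    where
    c≤m+1+F : c ≤ suc m + F
    c≤m+1+F = proj₁ (to (spec (s≤s z≤n) (≤-trans m<c+B c+B≤n)) e)
  ... | false = begin
    countTo P m + 0     ≡⟨ +-identityʳ _ ⟩
    countTo P m         ≡⟨ countTo-below m (<⇒≤ m<c+B) ⟩
    suc m + F ∸ c       ≡⟨ m≤n⇒m∸n≡0 (<⇒≤ m+1+F<c) ⟩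
    0                   ≡⟨ m≤n⇒m∸n≡0 m+1+F<c ⟨
    suc (suc m + F) ∸ c ∎
    where
    m+1+F<c : suc m + F < c
    m+1+F<c = ≰⇒> λ c≤m+1+F →
      contradiction (trans (sym e) (from (spec (s≤s z≤n) (≤-trans m<c+B c+B≤n)) (c≤m+1+F , m<c+B))) λ ()

  countTo-above : ∀ m → m ≤ n → c + B ≤ m → countTo P m ≡ countTo P (c + B)
  countTo-above zero _ c+B≤0 = cong (countTo P) (sym (n≤0⇒n≡0 c+B≤0))
  countTo-above (suc m) m<n c+B≤m+1 with m≤n⇒m<n∨m≡n c+B≤m+1
  ... | inj₂ c+B≡m+1 = cong (countTo P) (sym c+B≡m+1)
  ... | inj₁ c+B<m+1 with P (suc m) in e
  ...   | true = contradiction (proj₂ (to (spec (s≤s z≤n) m<n) e)) (<⇒≱ c+B<m+1)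
  ...   | false = trans (+-identityʳ _) (countTo-above m (<⇒≤ m<n) (s≤s⁻¹ c+B<m+1))

module PullbackInto (k ℓ n : ℕ) (o : ℕ → Bool) {j : ℕ} (i-free : o (suc j) ≡ false) (i≤n : suc j ≤ n) where

  i : ℕ
  i = suc j

  Parks : ℕ → Set
  Parks a = park k ℓ n o a ≡ just i

  rightRun leftRun backCount fwdCount : ℕ
  rightRun = runFwd o n (suc i) n
  leftRun = runBack o j
  backCount = rightRun ⊓ k
  fwdCount = leftReach k leftRun j ⊓ ℓ

  parks-at-i : Parks i
  parks-at-i rewrite i-free = refl

  parks-from-right⇒ : ∀ {a} → i < a → a ≤ n → Parks a → a ≤ i + backCount
  parks-from-right⇒ {suc b} i<a a≤n eq with o (suc b) in e
  ... | false = contradiction (just-injective eq) (>⇒≢ i<a)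
  ... | true with backFrom o b k in eb
  ...   | nothing = contradiction (fwdFrom-just-≥ n (suc (suc b)) ℓ eq) (<⇒≱ (m<n⇒m<1+n i<a))
  ...   | just x with eq
  ...     | refl = from (≤+⊓⇔ _ i rightRun k) (a≤i+rightRun , proj₁ found)
    where
    found : b < i + k × o i ≡ false × Occupied o (suc i) (suc b)
    found = to (backFrom-just⇔ b k (s≤s z≤n) (s≤s⁻¹ i<a)) eb
    a≤i+rightRun : suc b ≤ i + rightRun
    a≤i+rightRun = to (runFwd⇔ n i n i<a (≤-trans a≤n (m≤n+m n i)))
      (from (Occupied-extendʳ e) (proj₂ (proj₂ found)) , a≤n)

  parks-from-right⇐ : ∀ {a} → i < a → a ≤ i + backCount → Parks a
  parks-from-right⇐ {suc b} i<a h = parks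
    where
    a≤i+rightRun : suc b ≤ i + rightRun
    a≤i+rightRun = proj₁ (to (≤+⊓⇔ _ i rightRun k) h)
    occupied : Occupied o (suc i) (suc (suc b))
    occupied = proj₁ (from (runFwd⇔ n i n i<a (≤-trans (≤-trans a≤i+rightRun (runFwd-≤ n i n i≤n)) (m≤n+m n i)))
                            a≤i+rightRun)
    o-a : o (suc b) ≡ true
    o-a = occupied (suc b) (s≤s z≤n) i<a ≤-refl
    back : backFrom o b k ≡ just i
    back = from (backFrom-just⇔ b k (s≤s z≤n) (s≤s⁻¹ i<a))
      (proj₂ (to (≤+⊓⇔ _ i rightRun k) h) , i-free , to (Occupied-extendʳ o-a) occupied)
    parks : Parks (suc b)
    parks rewrite o-a | back = refl

  parks-from-left⇒ : ∀ {a} → 1 ≤ a → a < i → Parks a → Occupied o (a ∸ k) i × i ≤ a + ℓ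
  parks-from-left⇒ {suc b} _ a<i eq with o (suc b) in e
  ... | false = contradiction (just-injective eq) (<⇒≢ a<i)
  ... | true with backFrom o b k in eb
  ...   | just x with eq
  ...     | refl = contradiction (backFrom-just-≤ b k eb) (<⇒≱ (<⇒≤ a<i))
  parks-from-left⇒ {suc b} _ a<i eq | true | nothing =
    Occupied-++ (from (Occupied-extendʳ e) (to (backFrom-nothing⇔ b k) eb)) (proj₂ (proj₂ forward)) ,
    s≤s⁻¹ (proj₁ forward)
    where
    forward : i < suc (suc b) + ℓ × o i ≡ false × Occupied o (suc (suc b)) i
    forward = to (fwdFrom-just⇔ n (suc b) ℓ a<i i≤n) eq

  parks-from-left⇐ : ∀ {a} → 1 ≤ a → a < i → Occupied o (a ∸ k) i × i ≤ a + ℓ → Parks a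
  parks-from-left⇐ {suc b} _ a<i (occupied , i≤a+ℓ) = parks
    where
    o-a : o (suc b) ≡ true
    o-a = occupied (suc b) (s≤s z≤n) (m∸n≤m (suc b) k) a<i
    back : backFrom o b k ≡ nothing
    back = from (backFrom-nothing⇔ b k) (Occupied-⊆ ≤-refl (<⇒≤ a<i) occupied)
    forward : fwdFrom o n (suc (suc b)) ℓ ≡ just i
    forward = from (fwdFrom-just⇔ n (suc b) ℓ a<i i≤n)
      (s≤s i≤a+ℓ , i-free , Occupied-⊆ (≤-trans (m∸n≤m (suc b) k) (n≤1+n (suc b))) ≤-refl occupied)
    parks : Parks (suc b)
    parks rewrite o-a | back = forward

  parks-from-left⇔ : ∀ {a} → 1 ≤ a → a < i → Parks a ⇔ i ≤ a + fwdCount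
  parks-from-left⇔ {a} 1≤a a<i =
    ⇔-sym (≤+⊓⇔ i a _ ℓ)
    ⇔-∘ ((leftWindow⇔ ×-⇔ ⇔-refl) ⇔-∘ mk⇔ (parks-from-left⇒ 1≤a a<i) (parks-from-left⇐ 1≤a a<i))
    where
    leftWindow⇔ : Occupied o (a ∸ k) i ⇔ j < a + leftReach k leftRun j
    leftWindow⇔ = leftReach⇔ k (runBack-≤ j) 1≤a (s≤s⁻¹ a<i)
                  ⇔-∘ runBack⇔ j (≤-trans (m∸n≤m a k) (<⇒≤ a<i))

  Parks⇔window : ∀ {a} → 1 ≤ a → a ≤ n → Parks a ⇔ (i ≤ a + fwdCount × a ≤ i + backCount)
  Parks⇔window {a} 1≤a a≤n with <-cmp a i
  ... | tri< a<i _ _ =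
    mk⇔ (λ parks → to (parks-from-left⇔ 1≤a a<i) parks , ≤-trans (<⇒≤ a<i) (m≤m+n i backCount))
        (λ (i≤a+fwdCount , _) → from (parks-from-left⇔ 1≤a a<i) i≤a+fwdCount)
  ... | tri≈ _ refl _ = mk⇔ (λ _ → m≤m+n i fwdCount , m≤m+n i backCount) (λ _ → parks-at-i)
  ... | tri> _ _ i<a =
    mk⇔ (λ parks → ≤-trans (<⇒≤ i<a) (m≤m+n a fwdCount) , parks-from-right⇒ i<a a≤n parks)
        (λ (_ , a≤i+backCount) → parks-from-right⇐ i<a a≤i+backCount)

  countTo-Parks : countTo (λ a → isJust≡ (park k ℓ n o a) i) n ≡ backCount + fwdCount + 1
  countTo-Parks = countTo-window _ fwdCount<i i+backCount≤n
    (λ 1≤a a≤n → Parks⇔window 1≤a a≤n ⇔-∘ isJust≡⇔ _ i)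
    where
    fwdCount<i : fwdCount < i
    fwdCount<i = s≤s (≤-trans (m⊓n≤m _ ℓ) (leftReach-≤ k leftRun j (runBack-≤ j)))
    i+backCount≤n : i + backCount ≤ n
    i+backCount≤n = ≤-trans (+-monoʳ-≤ i (m⊓n≤m rightRun k)) (runFwd-≤ n i n i≤n)

occ-self : ∀ π i → occ π i i ≡ false
occ-self π i = trans (cong ((0 <ᵇ at π i) ∧_) (<ᵇ-irrefl (at π i))) (∧-zeroʳ _)
  where
  <ᵇ-irrefl : ∀ x → (x <ᵇ x) ≡ false
  <ᵇ-irrefl zero = refl
  <ᵇ-irrefl (suc x) = <ᵇ-irrefl x

corollary2p13 : (k ℓ m n : ℕ) → 1 ≤ m → m ≤ n →
    (π : List ℕ) → InS m n π →
    (i : ℕ) → 1 ≤ i → i ≤ n → 0 < at π i →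
    prefCount k ℓ n π i ≡ B k n π i + F k ℓ π i + 1
corollary2p13 k ℓ m n _ _ π _ (suc j) _ i≤n _ = begin
  prefCount k ℓ n π (suc j)                      ≡⟨ countTo-Parks ⟩
  backCount + fwdCount + 1                       ≡⟨ cong (λ f → backCount + f + 1) (F-cases≡leftReach⊓ℓ k ℓ leftRun j) ⟨
  B k n π (suc j) + F k ℓ π (suc j) + 1          ∎
  where
  open ≡-Reasoning
  open PullbackInto k ℓ n (occ π (suc j)) (occ-self π (suc j)) i≤n
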